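{- For every positive integer $n$: (1) $p_{\triangle_{00}}(n)=p_{A_{00}}(n)$, where $A_{00}$ is the set of partitions of dimension $\ge2$ with $\lambda_1<\lambda_2+\lambda_m$ and $k_1>k_m$; (2) $p_{\triangle_{01}}(n)=p_{A_{01}}(n)$, where $A_{01}$ is the set of partitions of dimension $\ge2$ with $\lambda_1>\lambda_2+\lambda_m$ and $k_1>k_m$; (3) $p_{\triangle_{10}}(n)=p_{A_{10}}(n)$, where $A_{10}$ is the set of partitions of dimension $\ge2$ with $\lambda_1<\lambda_2+\lambda_m$ and $k_1<k_m$; (4) $p_{\triangle_{11}}(n)=p_{A_{11}}(n)$, where $A_{11}$ is the set of partitions of dimension $\ge2$ with $\lambda_1>\lambda_2+\lambda_m$ and $k_1<k_m$.
   Context: A partition is written $(\lambda_1,\dots,\lambda_m)\times[k_1,\dots,k_m]$, where $m\ge1$, the parts $\lambda_i$ are integers with $\lambda_1>\dots>\lambda_m>0$ and the multiplicities $k_i$ are positive integers; $m$ is its dimension and $\sum k_i\lambda_i$ its size. For $m=2$, $\lambda_2+\lambda_m$ means $2\lambda_2$. For a set $S$ of partitions, $p_S(n)$ is the number of elements of $S$ of size $n$. The sets are: $\triangle_{00}$ = partitions of dimension $\ge3$ with $\lambda_1<\lambda_2+\lambda_m$ and $2\lambda_2<\lambda_1+\lambda_3$, together with $(\lambda_1,\lambda_2)\times[k_1,k_2]$ with $\lambda_1<2\lambda_2$, $3\lambda_2<2\lambda_1$; $\triangle_{01}$ = partitions of dimension $\ge3$ with $\lambda_1<\lambda_2+\lambda_m$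 and $2\lambda_2>\lambda_1+\lambda_3$, together with $(\lambda_1,\lambda_2)\times[k_1,k_2]$ with $\lambda_1<2\lambda_2$, $3\lambda_2>2\lambda_1$; $\triangle_{10}$ = partitions of dimension $\ge3$ with $\lambda_2+\lambda_m<\lambda_1<\lambda_2+2\lambda_m$, together with $(\lambda_1,\lambda_2)\times[k_1,k_2]$ with $2\lambda_2<\lambda_1<3\lambda_2$; $\triangle_{11}$ = partitions of dimension $\ge3$ with $\lambda_1>\lambda_2+2\lambda_m$, together with $(\lambda_1,\lambda_2)\times[k_1,k_2]$ with $\lambda_1>3\lambda_2$. -}

module Defs where

open import Data.Nat using (ℕ; _+_; _*_; _<_; _≤_)
open import Data.Product using (Σ; _×_; _,_; proj₁; proj₂)
open import Data.List using (List; []; _∷_; map; length)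
open import Data.Nat.ListAction using (sum)
open import Data.List.Relation.Unary.All using (All)
open import Data.List.Relation.Unary.Linked using (Linked)
open import Data.Fin using (Fin)
open import Data.Empty using (⊥)
open import Function.Bundles using (_↔_)
open import Relation.Binary.PropositionalEquality using (_≡_)

-- A partition (λ₁,…,λₘ)×[k₁,…,kₘ] is stored as the list of pairs
-- (λ₁,k₁) ∷ … ∷ (λₘ,kₘ) ∷ [], with m ≥ 1, λ₁ > … > λₘ > 0, kᵢ > 0.
record Partition : Set where
  constructor mkPartition
  field
    pairs      : List (ℕ × ℕ)
    nonempty   : 1 ≤ length pairs
    decreasing : Linked (λ a b → b < a) (map proj₁ pairs)
    partsPos   : All (λ p → 1 ≤ proj₁ p) pairs
    multsPos   : All (λ p → 1 ≤ proj₂ p) pairs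

open Partition public

dim : Partition → ℕ
dim π = length (pairs π)

size : Partition → ℕ
size π = sum (map (λ p → proj₂ p * proj₁ p) (pairs π))

lastOf : ℕ × ℕ → List (ℕ × ℕ) → ℕ × ℕ
lastOf x []       = x
lastOf x (y ∷ ys) = lastOf y ys

-- Conditions on the pair list. In each clause with ≥ 2 pairs,
-- λm = proj₁ (lastOf (λ₂,k₂) rest) and km = proj₂ (lastOf (λ₂,k₂) rest).

Tri00L : List (ℕ × ℕ) → Set
Tri00L ((l1 , _) ∷ (l2 , _) ∷ []) = (l1 < 2 * l2) × (3 * l2 < 2 * l1)
Tri00L ((l1 , _) ∷ (l2 , k2) ∷ (l3 , k3) ∷ rest) =
  (l1 < l2 + proj₁ (lastOf (l3 , k3) rest)) × (2 * l2 < l1 + l3)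
Tri00L _ = ⊥

Tri01L : List (ℕ × ℕ) → Set
Tri01L ((l1 , _) ∷ (l2 , _) ∷ []) = (l1 < 2 * l2) × (2 * l1 < 3 * l2)
Tri01L ((l1 , _) ∷ (l2 , k2) ∷ (l3 , k3) ∷ rest) =
  (l1 < l2 + proj₁ (lastOf (l3 , k3) rest)) × (l1 + l3 < 2 * l2)
Tri01L _ = ⊥

Tri10L : List (ℕ × ℕ) → Set
Tri10L ((l1 , _) ∷ (l2 , _) ∷ []) = (2 * l2 < l1) × (l1 < 3 * l2)
Tri10L ((l1 , _) ∷ (l2 , k2) ∷ (l3 , k3) ∷ rest) =
  (l2 + proj₁ (lastOf (l3 , k3) rest) < l1) × (l1 < l2 + 2 * proj₁ (lastOf (l3 , k3) rest))
Tri10L _ = ⊥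

Tri11L : List (ℕ × ℕ) → Set
Tri11L ((l1 , _) ∷ (l2 , _) ∷ []) = 3 * l2 < l1
Tri11L ((l1 , _) ∷ (l2 , k2) ∷ (l3 , k3) ∷ rest) =
  l2 + 2 * proj₁ (lastOf (l3 , k3) rest) < l1
Tri11L _ = ⊥

A00L : List (ℕ × ℕ) → Set
A00L ((l1 , k1) ∷ (l2 , k2) ∷ rest) =
  (l1 < l2 + proj₁ (lastOf (l2 , k2) rest)) × (proj₂ (lastOf (l2 , k2) rest) < k1)
A00L _ = ⊥

A01L : List (ℕ × ℕ) → Set
A01L ((l1 , k1) ∷ (l2 , k2) ∷ rest) =
  (l2 + proj₁ (lastOf (l2 , k2) rest) < l1) × (proj₂ (lastOf (l2 , k2) rest) < k1)
A01L _ = ⊥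

A10L : List (ℕ × ℕ) → Set
A10L ((l1 , k1) ∷ (l2 , k2) ∷ rest) =
  (l1 < l2 + proj₁ (lastOf (l2 , k2) rest)) × (k1 < proj₂ (lastOf (l2 , k2) rest))
A10L _ = ⊥

A11L : List (ℕ × ℕ) → Set
A11L ((l1 , k1) ∷ (l2 , k2) ∷ rest) =
  (l2 + proj₁ (lastOf (l2 , k2) rest) < l1) × (k1 < proj₂ (lastOf (l2 , k2) rest))
A11L _ = ⊥

Tri00 Tri01 Tri10 Tri11 A00 A01 A10 A11 : Partition → Set
Tri00 π = Tri00L (pairs π)
Tri01 π = Tri01L (pairs π)
Tri10 π = Tri10L (pairs π)
Tri11 π = Tri11L (pairs π)
A00 π = A00L (pairs π)
A01 π = A01L (pairs π)
A10 π = A10L (pairs π)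
A11 π = A11L (pairs π)

OfSize : (Partition → Set) → ℕ → Set
OfSize S n = Σ Partition (λ π → (size π ≡ n) × S π)

CountIs : (Partition → Set) → ℕ → ℕ → Set
CountIs S n c = Fin c ↔ OfSize S n

SameCount : (Partition → Set) → (Partition → Set) → ℕ → Set
SameCount S T n = Σ ℕ (λ c → CountIs S n c × CountIs T n c)

{-# OPTIONS --safe #-}
module Submission where

-- When k₁ > kₘ, pair each of the kₘ smallest parts with one of the largest ones:
--   (λ₁,…,λₘ)×[k₁,…,kₘ] ↦ (λ₁+λₘ, λ₁, λ₂, …, λₘ₋₁)×[kₘ, k₁−kₘ, k₂, …, kₘ₋₁].
-- When k₁ < kₘ, let each of the k₁ largest parts absorb one smallest part:
--   (λ₁,…,λₘ)×[k₁,…,kₘ] ↦ (λ₁+λₘ, λ₂, …, λₘ)×[k₁, k₂, …, kₘ−k₁].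
-- Both maps preserve the size and are undone by splitting the largest part at
-- the difference of the two largest (resp. of the largest and smallest) parts.
-- The defining comparison of the image, 2λ₁ against (λ₁+λₘ)+λ₂ in the first case
-- and λ₁+λₘ against λ₂+2λₘ in the second, is the comparison of λ₁ with λ₂+λₘ
-- shifted by λ₁, resp. λₘ; so A₀₀, A₀₁, A₁₀, A₁₁ are carried exactly onto
-- △₀₀, △₀₁, △₁₀, △₁₁ (for m = 2 read λ₂ as λₘ). The counts exist because the
-- partitions of n form a finite set.

open import Defs
open import Data.Empty using (⊥-elim)
open import Data.Fin using (Fin)
open import Data.Fin.Properties using (0↔⊥; 1↔⊤; +↔⊎)
open import Data.List using (List; []; _∷_; _∷ʳ_; length; map)
open import Data.List.Base using (initLast; _∷ʳ′_)
open import Data.List.Properties using (map-++)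
open import Data.List.Relation.Unary.All as All using (All; all?)
open import Data.List.Relation.Unary.Linked as Linked using (Linked; linked?)
open import Data.Nat using (ℕ; zero; suc; _+_; _*_; _∸_; _≤_; _<_; _>_; z≤n; s≤s; s≤s⁻¹; _≤?_; _<?_; _≟_)
open import Data.Nat.ListAction using (sum)
open import Data.Nat.ListAction.Properties using (sum-++)
open import Data.Nat.Properties
open import Data.Nat.Tactic.RingSolver using (solve; solve-∀)
open import Data.Product using (Σ; _×_; _,_; proj₁; proj₂)
open import Data.Product.Algebra using (Σ-assoc-alt)
open import Data.Product.Function.NonDependent.Propositional using (_×-⇔_)
open import Data.Product.Properties using (Σ-≡,≡→≡)
open import Data.Sum using (_⊎_; inj₁; inj₂)
open import Data.Sum.Function.Propositional using (_⊎-↔_)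
open import Function using (_∘_; id)
open import Function.Bundles using (_↔_; _⇔_; mk↔ₛ′; mk⇔; module Equivalence)
open import Function.Properties.Equivalence using () renaming (trans to ⇔-trans)
open import Function.Properties.Inverse using (↔-trans; ↔-sym)
open import Function.Related.Propositional using (≡⇒)
open import Relation.Binary.PropositionalEquality using (_≡_; refl; sym; trans; cong; cong₂; subst; subst₂)
open import Relation.Nullary using (¬_; Dec; yes; no; Irrelevant)
open import Relation.Nullary.Decidable using (True-↔; _×-dec_)

open Equivalence using (to; from)

private
  variable
    A B : Set
    lo lo′ hi hi′ : ℕ

Finite : Set → Set
Finite A = Σ ℕ λ c → Fin c ↔ A

finite-↔ : Finite A → A ↔ B → Finite B
finite-↔ (c , e) f = c , ↔-trans e f

finite-⊎ : Finite A → Finite B → Finite (A ⊎ B)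
finite-⊎ (a , e) (b , f) = a + b , ↔-trans +↔⊎ (e ⊎-↔ f)

finite-proposition : Dec A → Irrelevant A → Finite A
finite-proposition A?@(yes _) irr = 1 , ↔-trans 1↔⊤ (True-↔ A? irr)
finite-proposition A?@(no _)  irr = 0 , ↔-trans 0↔⊥ (True-↔ A? irr)

finite-empty : ¬ A → Finite A
finite-empty ¬a = finite-proposition (no ¬a) (λ a → ⊥-elim (¬a a))

Σℕ-↔ : {B : ℕ → Set} → Σ ℕ B ↔ (B zero ⊎ Σ ℕ (B ∘ suc))
Σℕ-↔ = mk↔ₛ′ (λ { (zero , b) → inj₁ b ; (suc k , b) → inj₂ (k , b) })
             (λ { (inj₁ b) → zero , b ; (inj₂ (k , b)) → suc k , b })
             (λ { (inj₁ _) → refl ; (inj₂ _) → refl })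
             (λ { (zero , _) → refl ; (suc _ , _) → refl })

Σ-List-↔ : {P : List A → Set} → Σ (List A) P ↔ (P [] ⊎ Σ A λ x → Σ (List A) λ L → P (x ∷ L))
Σ-List-↔ = mk↔ₛ′ (λ { ([] , p) → inj₁ p ; (x ∷ L , p) → inj₂ (x , L , p) })
                 (λ { (inj₁ p) → [] , p ; (inj₂ (x , L , p)) → x ∷ L , p })
                 (λ { (inj₁ _) → refl ; (inj₂ _) → refl })
                 (λ { ([] , _) → refl ; (_ ∷ _ , _) → refl })

finite-Σℕ : ∀ N {B : ℕ → Set} → (∀ k → Finite (B k)) → (∀ {k} → B k → k ≤ N) → Finite (Σ ℕ B)
finite-Σℕ zero    fin bound =
  finite-↔ (finite-⊎ (fin 0) (finite-empty λ (_ , b) → n≮0 (bound b))) (↔-sym Σℕ-↔)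
finite-Σℕ (suc N) fin bound =
  finite-↔ (finite-⊎ (fin 0) (finite-Σℕ N (fin ∘ suc) (λ b → s≤s⁻¹ (bound b)))) (↔-sym Σℕ-↔)

Pair : Set
Pair = ℕ × ℕ

Bounded : ℕ → Pair → Set
Bounded N (l , k) = l ≤ N × k ≤ N

finite-boundedLists : ∀ d N {P : List Pair → Set} → (∀ L → Finite (P L)) →
  (∀ {L} → P L → length L ≤ d) → (∀ {L} → P L → All (Bounded N) L) → Finite (Σ (List Pair) P)
finite-boundedLists zero N fin length≤ bounded =
  finite-↔ (finite-⊎ (fin []) (finite-empty λ (_ , _ , p) → n≮0 (length≤ p))) (↔-sym Σ-List-↔)
finite-boundedLists (suc d) N {P} fin length≤ bounded =
  finite-↔ (finite-⊎ (fin []) (finite-↔ heads (↔-sym Σ-assoc-alt))) (↔-sym Σ-List-↔)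
  where
  heads : Finite (Σ ℕ λ l → Σ ℕ λ k → Σ (List Pair) λ L → P ((l , k) ∷ L))
  heads = finite-Σℕ N
    (λ l → finite-Σℕ N
      (λ k → finite-boundedLists d N (λ L → fin _) (λ p → s≤s⁻¹ (length≤ p)) (λ p → All.tail (bounded p)))
      (λ (_ , p) → proj₂ (All.head (bounded p))))
    (λ (_ , _ , p) → proj₁ (All.head (bounded p)))

weight : List Pair → ℕ
weight L = sum (map (λ p → proj₂ p * proj₁ p) L)

weight-∷ʳ : ∀ I l k → weight (I ∷ʳ (l , k)) ≡ weight I + k * l
weight-∷ʳ I l k =
  trans (cong sum (map-++ _ I _)) (trans (sum-++ (map _ I) _) (cong (weight I +_) (+-identityʳ (k * l))))

WellFormed : List Pair → Set
WellFormed L = 1 ≤ length L × Linked (λ a b → b < a) (map proj₁ L) ×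
               All (λ p → 1 ≤ proj₁ p) L × All (λ p → 1 ≤ proj₂ p) L

OfWeight : (List Pair → Set) → ℕ → List Pair → Set
OfWeight S n L = WellFormed L × weight L ≡ n × S L

OfSize↔OfWeight : ∀ S {n} → OfSize (S ∘ pairs) n ↔ Σ (List Pair) (OfWeight S n)
OfSize↔OfWeight S = mk↔ₛ′ (λ (mkPartition L a b c d , w , s) → L , (a , b , c , d) , w , s)
                          (λ (L , (a , b , c , d) , w , s) → mkPartition L a b c d , w , s)
                          (λ _ → refl) (λ _ → refl)

×-irrelevant : Irrelevant A → Irrelevant B → Irrelevant (A × B)
×-irrelevant irrA irrB (a , b) (a′ , b′) = cong₂ _,_ (irrA a a′) (irrB b b′)

wellFormed? : ∀ L → Dec (WellFormed L)
wellFormed? L = (1 ≤? length L) ×-dec linked? (λ a b → b <? a) (map proj₁ L) ×-dec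
                all? (λ p → 1 ≤? proj₁ p) L ×-dec all? (λ p → 1 ≤? proj₂ p) L

wellFormed-irrelevant : ∀ L → Irrelevant (WellFormed L)
wellFormed-irrelevant L = ×-irrelevant ≤-irrelevant (×-irrelevant (Linked.irrelevant <-irrelevant)
                          (×-irrelevant (All.irrelevant ≤-irrelevant) (All.irrelevant ≤-irrelevant)))

OfWeight-irrelevant : ∀ {S n} → (∀ L → Irrelevant (S L)) → ∀ L → Irrelevant (OfWeight S n L)
OfWeight-irrelevant irrS L = ×-irrelevant (wellFormed-irrelevant L) (×-irrelevant ≡-irrelevant (irrS L))

bounded-by-weight : ∀ L → All (λ p → 1 ≤ proj₁ p) L → All (λ p → 1 ≤ proj₂ p) L →
                    length L ≤ weight L × All (Bounded (weight L)) L
bounded-by-weight [] All.[] All.[] = z≤n , All.[]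
bounded-by-weight ((suc l , suc k) ∷ L) (_ All.∷ parts) (_ All.∷ mults) with bounded-by-weight L parts mults
... | length≤ , bounded =
  +-mono-≤ (s≤s z≤n) length≤ ,
  (≤-trans (m≤n*m (suc l) (suc k)) (m≤m+n _ _) , ≤-trans (m≤m*n (suc k) (suc l)) (m≤m+n _ _)) All.∷
  All.map (λ (l≤ , k≤) → ≤-trans l≤ (m≤n+m _ _) , ≤-trans k≤ (m≤n+m _ _)) bounded

finite-OfWeight : ∀ {S} → (∀ L → Dec (S L)) → (∀ L → Irrelevant (S L)) → ∀ n →
                  Finite (Σ (List Pair) (OfWeight S n))
finite-OfWeight S? irrS n = finite-boundedLists n n
  (λ L → finite-proposition (wellFormed? L ×-dec (weight L ≟ n) ×-dec S? L) (OfWeight-irrelevant irrS L))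
  (λ {L} ((_ , _ , parts , mults) , w , _) →
     subst (length L ≤_) w (proj₁ (bounded-by-weight L parts mults)))
  (λ {L} ((_ , _ , parts , mults) , w , _) →
     subst (λ N → All (Bounded N) L) w (proj₂ (bounded-by-weight L parts mults)))

sameCount-by-↔ : ∀ n {S T} → (∀ L → Dec (S L)) → (∀ L → Irrelevant (S L)) →
  Σ (List Pair) (OfWeight S n) ↔ Σ (List Pair) (OfWeight T n) → SameCount (T ∘ pairs) (S ∘ pairs) n
sameCount-by-↔ n {S} {T} S? irrS S↔T with finite-OfWeight S? irrS n
... | c , e = c , ↔-trans e (↔-trans S↔T (↔-sym (OfSize↔OfWeight T))) , ↔-trans e (↔-sym (OfSize↔OfWeight S))

Chain : ℕ → ℕ → List Pair → Set
Chain lo hi []            = lo < hi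
Chain lo hi ((l , k) ∷ L) = l < hi × 1 ≤ k × Chain lo l L

topPart : List Pair → ℕ → ℕ
topPart []            lo = lo
topPart ((l , _) ∷ _) _  = l

chain-lo<hi : ∀ L → Chain lo hi L → lo < hi
chain-lo<hi []            lo<hi          = lo<hi
chain-lo<hi ((l , _) ∷ L) (l<hi , _ , c) = <-trans (chain-lo<hi L c) l<hi

chain-top : ∀ L → Chain lo hi L → topPart L lo < hi
chain-top []      lo<hi      = lo<hi
chain-top (_ ∷ _) (l<hi , _) = l<hi

chain-bottom : ∀ y L → Chain lo hi (y ∷ L) → lo < proj₁ (lastOf y L)
chain-bottom _ []      (_ , _ , lo<l) = lo<l
chain-bottom _ (y ∷ L) (_ , _ , c)    = chain-bottom y L c

Chain-capʳ : ∀ L → Chain lo hi L → topPart L lo < hi′ → Chain lo hi′ L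
Chain-capʳ []      _             lo<hi′ = lo<hi′
Chain-capʳ (_ ∷ _) (_ , k>0 , c) l<hi′  = l<hi′ , k>0 , c

Chain-lowerˡ : ∀ L → lo′ ≤ lo → Chain lo hi L → Chain lo′ hi L
Chain-lowerˡ []            lo′≤lo lo<hi           = ≤-<-trans lo′≤lo lo<hi
Chain-lowerˡ ((_ , _) ∷ L) lo′≤lo (l<hi , k>0 , c) = l<hi , k>0 , Chain-lowerˡ L lo′≤lo c

Chain-raiseˡ : ∀ y L → Chain lo hi (y ∷ L) → lo′ < proj₁ (lastOf y L) → Chain lo′ hi (y ∷ L)
Chain-raiseˡ _ []      (l<hi , k>0 , _) lo′<l = l<hi , k>0 , lo′<l
Chain-raiseˡ _ (y ∷ L) (l<hi , k>0 , c) lo′<  = l<hi , k>0 , Chain-raiseˡ y L c lo′<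

Chain-∷ʳ : ∀ I {l k} → Chain lo hi (I ∷ʳ (l , k)) ⇔ (Chain l hi I × 1 ≤ k × lo < l)
Chain-∷ʳ I = mk⇔ (split I) (join I)
  where
  split : ∀ I {hi l k} → Chain lo hi (I ∷ʳ (l , k)) → Chain l hi I × 1 ≤ k × lo < l
  split []              c                  = c
  split ((l′ , k′) ∷ I) (l′<hi , k′>0 , c) with split I c
  ... | c′ , k>0 , lo<l = (l′<hi , k′>0 , c′) , k>0 , lo<l
  join : ∀ I {hi l k} → Chain l hi I × 1 ≤ k × lo < l → Chain lo hi (I ∷ʳ (l , k))
  join []              c                                   = c
  join ((l′ , k′) ∷ I) ((l′<hi , k′>0 , c) , k>0 , lo<l) = l′<hi , k′>0 , join I (c , k>0 , lo<l)

wellFormed⇔chain : ∀ {l k L} → WellFormed ((l , k) ∷ L) ⇔ (1 ≤ k × Chain 0 l L)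
wellFormed⇔chain {l} {k} {L} =
  mk⇔ (λ { (_ , linked , l>0 All.∷ parts , k>0 All.∷ mults) → k>0 , toChain l L l>0 linked parts mults })
      (λ (k>0 , c) → s≤s z≤n , linked l L c , chain-lo<hi L c All.∷ parts l L c , k>0 All.∷ mults l L c)
  where
  toChain : ∀ hi L → 0 < hi → Linked (λ a b → b < a) (hi ∷ map proj₁ L) →
            All (λ p → 1 ≤ proj₁ p) L → All (λ p → 1 ≤ proj₂ p) L → Chain 0 hi L
  toChain hi []            hi>0 _ _ _ = hi>0
  toChain hi ((l , k) ∷ L) _ (l<hi Linked.∷ linked) (l>0 All.∷ parts) (k>0 All.∷ mults) =
    l<hi , k>0 , toChain l L l>0 linked parts mults
  linked : ∀ hi L → Chain 0 hi L → Linked (λ a b → b < a) (hi ∷ map proj₁ L)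
  linked hi []            _              = Linked.[-]
  linked hi ((l , _) ∷ L) (l<hi , _ , c) = l<hi Linked.∷ linked l L c
  parts : ∀ hi L → Chain 0 hi L → All (λ p → 1 ≤ proj₁ p) L
  parts hi []            _           = All.[]
  parts hi ((l , _) ∷ L) (_ , _ , c) = chain-lo<hi L c All.∷ parts l L c
  mults : ∀ hi L → Chain 0 hi L → All (λ p → 1 ≤ proj₂ p) L
  mults hi []            _             = All.[]
  mults hi ((l , _) ∷ L) (_ , k>0 , c) = k>0 All.∷ mults l L c

frame : A × List A × A → List A
frame (x , I , z) = x ∷ I ∷ʳ z

cons₂ : A × A × List A → List A
cons₂ (x , y , J) = x ∷ y ∷ J

initLast-∷ʳ : ∀ (I : List A) z → initLast (I ∷ʳ z) ≡ I ∷ʳ′ z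
initLast-∷ʳ []      z = refl
initLast-∷ʳ (x ∷ I) z rewrite initLast-∷ʳ I z = refl

lastOf-∷ʳ : ∀ y I (z : Pair) → lastOf y (I ∷ʳ z) ≡ z
lastOf-∷ʳ y []      z = refl
lastOf-∷ʳ y (x ∷ I) z = lastOf-∷ʳ x I z

module _ {P : List A → Set} (nil : ¬ P []) (singleton : ∀ x → ¬ P (x ∷ [])) where

  Σ-frame-↔ : Σ (List A) P ↔ Σ (A × List A × A) (P ∘ frame)
  Σ-frame-↔ = mk↔ₛ′ split (λ (f , p) → frame f , p) split∘frame frame∘split
    where
    split : Σ (List A) P → Σ (A × List A × A) (P ∘ frame)
    split ([] , p) = ⊥-elim (nil p)
    split (x ∷ L , p) with initLast L
    ... | []      = ⊥-elim (singleton x p)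
    ... | I ∷ʳ′ z = (x , I , z) , p
    split∘frame : ∀ fp → split (frame (proj₁ fp) , proj₂ fp) ≡ fp
    split∘frame ((x , I , z) , p) rewrite initLast-∷ʳ I z = refl
    frame∘split : ∀ Lp → (frame (proj₁ (split Lp)) , proj₂ (split Lp)) ≡ Lp
    frame∘split ([] , p) = ⊥-elim (nil p)
    frame∘split (x ∷ L , p) with initLast L
    ... | []      = ⊥-elim (singleton x p)
    ... | I ∷ʳ′ z = refl

  Σ-cons₂-↔ : Σ (List A) P ↔ Σ (A × A × List A) (P ∘ cons₂)
  Σ-cons₂-↔ = mk↔ₛ′ split (λ (h , p) → cons₂ h , p) (λ _ → refl) cons₂∘split
    where
    split : Σ (List A) P → Σ (A × A × List A) (P ∘ cons₂)
    split ([] , p)        = ⊥-elim (nil p)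
    split (x ∷ [] , p)    = ⊥-elim (singleton x p)
    split (x ∷ y ∷ J , p) = (x , y , J) , p
    cons₂∘split : ∀ Lp → (cons₂ (proj₁ (split Lp)) , proj₂ (split Lp)) ≡ Lp
    cons₂∘split ([] , p)        = ⊥-elim (nil p)
    cons₂∘split (x ∷ [] , p)    = ⊥-elim (singleton x p)
    cons₂∘split (x ∷ y ∷ J , p) = refl

inverseOn-↔ : {P : A → Set} {Q : B → Set} → (∀ a → Irrelevant (P a)) → (∀ b → Irrelevant (Q b)) →
  (f : A → B) (g : B → A) → (∀ {a} → P a → Q (f a)) → (∀ {b} → Q b → P (g b)) →
  (∀ {a} → P a → g (f a) ≡ a) → (∀ {b} → Q b → f (g b) ≡ b) → Σ A P ↔ Σ B Q
inverseOn-↔ irrP irrQ f g f⁺ g⁺ g∘f f∘g =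
  mk↔ₛ′ (λ (a , p) → f a , f⁺ p) (λ (b , q) → g b , g⁺ q)
        (λ (b , q) → Σ-≡,≡→≡ (f∘g q , irrQ _ _ _)) (λ (a , p) → Σ-≡,≡→≡ (g∘f p , irrP _ _ _))

-- In a frame ((λ₁ , k₁) , I , (λₘ , kₘ)) the paper's λ₂ is topPart I λₘ, which is λₘ when m = 2.
Frame Head : Set
Frame = Pair × List Pair × Pair
Head  = Pair × Pair × List Pair

FrameOK : Frame → Set
FrameOK ((l₁ , k₁) , I , (lₘ , kₘ)) = 1 ≤ k₁ × Chain lₘ l₁ I × 1 ≤ kₘ × 0 < lₘ

wellFormed⇔frameOK : ∀ f → WellFormed (frame f) ⇔ FrameOK f
wellFormed⇔frameOK ((l₁ , k₁) , I , (lₘ , kₘ)) =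
  ⇔-trans wellFormed⇔chain (mk⇔ id id ×-⇔ Chain-∷ʳ I)

record ReadsAs {V : Set} (view : V → List Pair) (S : List Pair → Set) (Q : V → Set) : Set where
  field
    irrelevant : ∀ L → Irrelevant (S L)
    nil        : ¬ S []
    singleton  : ∀ (x : Pair) → ¬ S (x ∷ [])
    onView     : ∀ v → S (view v) ⇔ Q v

record ShiftInvariant (R : ℕ → ℕ → Set) : Set where
  field
    shift   : ∀ {a b} c → R a b → R (a + c) (b + c)
    unshift : ∀ {a b} c → R (a + c) (b + c) → R a b

  rebalance : ∀ {a b a′ b′} c c′ → a + c ≡ a′ + c′ → b + c ≡ b′ + c′ → R a b → R a′ b′
  rebalance c c′ ea eb = unshift c′ ∘ subst₂ R ea eb ∘ shift c

  last-fused⁺ : ∀ {l m} → R m l → R (l + m) (2 * l)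
  last-fused⁺ {l} {m} = rebalance l 0 (solve (l ∷ m ∷ [])) (solve (l ∷ []))

  last-fused⁻ : ∀ {l m} → R (l + m) (2 * l) → R m l
  last-fused⁻ {l} {m} = rebalance 0 l (solve (l ∷ m ∷ [])) (solve (l ∷ []))

  two-parts-fused⁺ : ∀ {l m} → R l (m + m) → R (3 * l) (2 * (l + m))
  two-parts-fused⁺ {l} {m} = rebalance (2 * l) 0 (solve (l ∷ [])) (solve (l ∷ m ∷ []))

  two-parts-fused⁻ : ∀ {l m} → R (3 * l) (2 * (l + m)) → R l (m + m)
  two-parts-fused⁻ {l} {m} = rebalance 0 (2 * l) (solve (l ∷ [])) (solve (l ∷ m ∷ []))

  parts-fused⁺ : ∀ {l m s} → R l (s + m) → R (2 * l) ((l + m) + s)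
  parts-fused⁺ {l} {m} {s} = rebalance l 0 (solve (l ∷ [])) (solve (l ∷ m ∷ s ∷ []))

  parts-fused⁻ : ∀ {l m s} → R (2 * l) ((l + m) + s) → R l (s + m)
  parts-fused⁻ {l} {m} {s} = rebalance 0 l (solve (l ∷ [])) (solve (l ∷ m ∷ s ∷ []))

  first-fused⁺ : ∀ {l m s} → R l (s + m) → R (l + m) (s + 2 * m)
  first-fused⁺ {l} {m} {s} = rebalance m 0 (solve (l ∷ m ∷ [])) (solve (m ∷ s ∷ []))

  first-fused⁻ : ∀ {l m s} → R (l + m) (s + 2 * m) → R l (s + m)
  first-fused⁻ {l} {m} {s} = rebalance 0 m (solve (l ∷ m ∷ [])) (solve (m ∷ s ∷ []))

<-shiftInvariant : ShiftInvariant _<_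
<-shiftInvariant = record { shift = λ c → +-monoˡ-< c ; unshift = λ c → +-cancelʳ-< c _ _ }

-- m > n unfolds to n < m, so the proofs for _<_ serve verbatim.
>-shiftInvariant : ShiftInvariant _>_
>-shiftInvariant = record { shift = λ c → +-monoˡ-< c ; unshift = λ c → +-cancelʳ-< c _ _ }

open ShiftInvariant <-shiftInvariant using ()
  renaming (last-fused⁺ to <-last-fused⁺; last-fused⁻ to <-last-fused⁻)

-- Fusing the kₘ smallest parts into largest ones when k₁ > kₘ

fuse-weight : ∀ k e l m w → k * (l + m) + (e * l + w) ≡ (k + e) * l + (w + k * m)
fuse-weight = solve-∀

FuseLastSource : (ℕ → ℕ → Set) → Frame → Set
FuseLastSource R ((l₁ , k₁) , I , (lₘ , kₘ)) = R l₁ (topPart I lₘ + lₘ) × kₘ < k₁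

FuseLastTarget : (ℕ → ℕ → Set) → Head → Set
FuseLastTarget R ((μ₁ , _) , (μ₂ , _) , [])            = μ₁ < 2 * μ₂ × R (3 * μ₂) (2 * μ₁)
FuseLastTarget R ((μ₁ , _) , (μ₂ , _) , (μ₃ , k₃) ∷ J) =
  μ₁ < μ₂ + proj₁ (lastOf (μ₃ , k₃) J) × R (2 * μ₂) (μ₁ + μ₃)

fuseLast : Frame → Head
fuseLast ((l₁ , k₁) , I , (lₘ , kₘ)) = (l₁ + lₘ , kₘ) , (l₁ , k₁ ∸ kₘ) , I

unfuseLast : Head → Frame
unfuseLast ((μ₁ , a) , (μ₂ , b) , J) = (μ₂ , a + b) , J , (μ₁ ∸ μ₂ , a)

unfuseLast∘fuseLast : ∀ {l₁ k₁ I lₘ kₘ} → kₘ ≤ k₁ →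
  unfuseLast (fuseLast ((l₁ , k₁) , I , (lₘ , kₘ))) ≡ ((l₁ , k₁) , I , (lₘ , kₘ))
unfuseLast∘fuseLast {l₁} {lₘ = lₘ} kₘ≤k₁ rewrite m+[n∸m]≡n kₘ≤k₁ | m+n∸m≡n l₁ lₘ = refl

fuseLast∘unfuseLast : ∀ {μ₁ a μ₂ b J} → μ₂ ≤ μ₁ →
  fuseLast (unfuseLast ((μ₁ , a) , (μ₂ , b) , J)) ≡ ((μ₁ , a) , (μ₂ , b) , J)
fuseLast∘unfuseLast {a = a} {b = b} μ₂≤μ₁ rewrite m+[n∸m]≡n μ₂≤μ₁ | m+n∸m≡n a b = refl

weight-fuseLast : ∀ l₁ k₁ I lₘ kₘ → kₘ ≤ k₁ →
  weight (cons₂ (fuseLast ((l₁ , k₁) , I , (lₘ , kₘ)))) ≡ weight (frame ((l₁ , k₁) , I , (lₘ , kₘ)))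
weight-fuseLast l₁ k₁ I lₘ kₘ kₘ≤k₁ with m≤n⇒∃[o]m+o≡n kₘ≤k₁
... | e , refl rewrite m+n∸m≡n kₘ e =
  trans (fuse-weight kₘ e l₁ lₘ (weight I)) (cong ((kₘ + e) * l₁ +_) (sym (weight-∷ʳ I lₘ kₘ)))

weight-unfuseLast : ∀ μ₁ a μ₂ b J → μ₂ ≤ μ₁ →
  weight (frame (unfuseLast ((μ₁ , a) , (μ₂ , b) , J))) ≡ weight (cons₂ ((μ₁ , a) , (μ₂ , b) , J))
weight-unfuseLast μ₁ a μ₂ b J μ₂≤μ₁ =
  trans (sym (weight-fuseLast μ₂ (a + b) J (μ₁ ∸ μ₂) a (m≤m+n a b)))
        (cong (weight ∘ cons₂) (fuseLast∘unfuseLast {μ₁} {a} {μ₂} {b} {J} μ₂≤μ₁))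

module _ {R : ℕ → ℕ → Set} (R-shift : ShiftInvariant R) where
  open ShiftInvariant R-shift

  fuseLast-target : ∀ {l₁ k₁ I lₘ kₘ} → Chain lₘ l₁ I → FuseLastSource R ((l₁ , k₁) , I , (lₘ , kₘ)) →
                    FuseLastTarget R (fuseLast ((l₁ , k₁) , I , (lₘ , kₘ)))
  fuseLast-target {I = []}                 lₘ<l₁ (r , _) = <-last-fused⁺ lₘ<l₁ , two-parts-fused⁺ r
  fuseLast-target {l₁} {I = (l₂ , k₂) ∷ I} c     (r , _) =
    +-monoʳ-< l₁ (chain-bottom (l₂ , k₂) I c) , parts-fused⁺ r

  unfuseLast-source : ∀ {μ₁ a μ₂ b J} → μ₂ < μ₁ → Chain 0 μ₂ J → FuseLastTarget R ((μ₁ , a) , (μ₂ , b) , J) →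
                      Chain (μ₁ ∸ μ₂) μ₂ J × R μ₂ (topPart J (μ₁ ∸ μ₂) + (μ₁ ∸ μ₂))
  unfuseLast-source {μ₁} {μ₂ = μ₂} μ₂<μ₁ c t with μ₁ ∸ μ₂ | m+[n∸m]≡n (<⇒≤ μ₂<μ₁)
  unfuseLast-source {J = []}                      _ _ (t₁ , t₂) | _ | refl =
    <-last-fused⁻ t₁ , two-parts-fused⁻ t₂
  unfuseLast-source {μ₂ = μ₂} {J = (μ₃ , k₃) ∷ J} _ c (t₁ , t₂) | d | refl =
    Chain-raiseˡ (μ₃ , k₃) J c (+-cancelˡ-< μ₂ d _ t₁) , parts-fused⁻ t₂

  fuseLast-↔ : ∀ {S T} → ReadsAs frame S (FuseLastSource R) → ReadsAs cons₂ T (FuseLastTarget R) →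
               ∀ n → Σ (List Pair) (OfWeight S n) ↔ Σ (List Pair) (OfWeight T n)
  fuseLast-↔ {S} {T} src tgt n =
    ↔-trans (Σ-frame-↔ (λ (_ , _ , s) → Src.nil s) (λ x (_ , _ , s) → Src.singleton x s))
   (↔-trans (inverseOn-↔ (OfWeight-irrelevant Src.irrelevant ∘ frame) (OfWeight-irrelevant Tgt.irrelevant ∘ cons₂)
                         fuseLast unfuseLast forward backward back-and-forth forth-and-back)
            (↔-sym (Σ-cons₂-↔ (λ (_ , _ , t) → Tgt.nil t) (λ x (_ , _ , t) → Tgt.singleton x t))))
    where
    module Src = ReadsAs src
    module Tgt = ReadsAs tgt

    forward : ∀ {f} → OfWeight S n (frame f) → OfWeight T n (cons₂ (fuseLast f))
    forward {(l₁ , k₁) , I , (lₘ , kₘ)} (wf , w , s)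
      with to (wellFormed⇔frameOK _) wf | to (Src.onView _) s
    ... | _ , c , kₘ>0 , lₘ>0 | source@(_ , kₘ<k₁) =
      from wellFormed⇔chain (kₘ>0 , m<m+n l₁ lₘ>0 , m<n⇒0<n∸m kₘ<k₁ , Chain-lowerˡ I z≤n c) ,
      trans (weight-fuseLast l₁ k₁ I lₘ kₘ (<⇒≤ kₘ<k₁)) w ,
      from (Tgt.onView _) (fuseLast-target c source)

    backward : ∀ {h} → OfWeight T n (cons₂ h) → OfWeight S n (frame (unfuseLast h))
    backward {(μ₁ , a) , (μ₂ , b) , J} (wf , w , t) with to wellFormed⇔chain wf
    ... | a>0 , μ₂<μ₁ , b>0 , c with unfuseLast-source μ₂<μ₁ c (to (Tgt.onView _) t)
    ... | c′ , r =
      from (wellFormed⇔frameOK _) (≤-trans a>0 (m≤m+n a b) , c′ , a>0 , m<n⇒0<n∸m μ₂<μ₁) ,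
      trans (weight-unfuseLast μ₁ a μ₂ b J (<⇒≤ μ₂<μ₁)) w ,
      from (Src.onView _) (r , m<m+n a b>0)

    back-and-forth : ∀ {f} → OfWeight S n (frame f) → unfuseLast (fuseLast f) ≡ f
    back-and-forth (_ , _ , s) = unfuseLast∘fuseLast (<⇒≤ (proj₂ (to (Src.onView _) s)))

    forth-and-back : ∀ {h} → OfWeight T n (cons₂ h) → fuseLast (unfuseLast h) ≡ h
    forth-and-back (wf , _) = fuseLast∘unfuseLast (<⇒≤ (proj₁ (proj₂ (to wellFormed⇔chain wf))))

-- Fusing the k₁ largest parts with smallest ones when k₁ < kₘ

fuseFirst-weight : ∀ k e l m w → k * (l + m) + (w + e * m) ≡ k * l + (w + (k + e) * m)
fuseFirst-weight = solve-∀

FuseFirstSource : (ℕ → ℕ → Set) → Frame → Set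
FuseFirstSource R ((l₁ , k₁) , I , (lₘ , kₘ)) = R l₁ (topPart I lₘ + lₘ) × k₁ < kₘ

FuseFirstTarget : (ℕ → ℕ → Set) → Frame → Set
FuseFirstTarget R ((μ₁ , _) , I , (μₘ , _)) = topPart I μₘ + μₘ < μ₁ × R μ₁ (topPart I μₘ + 2 * μₘ)

fuseFirst : Frame → Frame
fuseFirst ((l₁ , k₁) , I , (lₘ , kₘ)) = (l₁ + lₘ , k₁) , I , (lₘ , kₘ ∸ k₁)

unfuseFirst : Frame → Frame
unfuseFirst ((μ₁ , a) , I , (μₘ , b)) = (μ₁ ∸ μₘ , a) , I , (μₘ , b + a)

unfuseFirst∘fuseFirst : ∀ {l₁ k₁ I lₘ kₘ} → k₁ ≤ kₘ →
  unfuseFirst (fuseFirst ((l₁ , k₁) , I , (lₘ , kₘ))) ≡ ((l₁ , k₁) , I , (lₘ , kₘ))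
unfuseFirst∘fuseFirst {l₁} {lₘ = lₘ} k₁≤kₘ rewrite m+n∸n≡m l₁ lₘ | m∸n+n≡m k₁≤kₘ = refl

fuseFirst∘unfuseFirst : ∀ {μ₁ a I μₘ b} → μₘ ≤ μ₁ →
  fuseFirst (unfuseFirst ((μ₁ , a) , I , (μₘ , b))) ≡ ((μ₁ , a) , I , (μₘ , b))
fuseFirst∘unfuseFirst {a = a} {b = b} μₘ≤μ₁ rewrite m∸n+n≡m μₘ≤μ₁ | m+n∸n≡m b a = refl

weight-fuseFirst : ∀ l₁ k₁ I lₘ kₘ → k₁ ≤ kₘ →
  weight (frame (fuseFirst ((l₁ , k₁) , I , (lₘ , kₘ)))) ≡ weight (frame ((l₁ , k₁) , I , (lₘ , kₘ)))
weight-fuseFirst l₁ k₁ I lₘ kₘ k₁≤kₘ with m≤n⇒∃[o]m+o≡n k₁≤kₘ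
... | e , refl rewrite m+n∸m≡n k₁ e | weight-∷ʳ I lₘ e | weight-∷ʳ I lₘ (k₁ + e) =
  fuseFirst-weight k₁ e l₁ lₘ (weight I)

weight-unfuseFirst : ∀ μ₁ a I μₘ b → μₘ ≤ μ₁ →
  weight (frame (unfuseFirst ((μ₁ , a) , I , (μₘ , b)))) ≡ weight (frame ((μ₁ , a) , I , (μₘ , b)))
weight-unfuseFirst μ₁ a I μₘ b μₘ≤μ₁ =
  trans (sym (weight-fuseFirst (μ₁ ∸ μₘ) a I μₘ (b + a) (m≤n+m a b)))
        (cong (weight ∘ frame) (fuseFirst∘unfuseFirst {μ₁} {a} {I} {μₘ} {b} μₘ≤μ₁))

module _ {R : ℕ → ℕ → Set} (R-shift : ShiftInvariant R) where
  open ShiftInvariant R-shift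

  fuseFirst-target : ∀ {l₁ k₁ I lₘ kₘ} → Chain lₘ l₁ I → FuseFirstSource R ((l₁ , k₁) , I , (lₘ , kₘ)) →
                     FuseFirstTarget R (fuseFirst ((l₁ , k₁) , I , (lₘ , kₘ)))
  fuseFirst-target {I = I} {lₘ} c (r , _) = +-monoˡ-< lₘ (chain-top I c) , first-fused⁺ r

  unfuseFirst-source : ∀ {μ₁ a I μₘ b} → Chain μₘ μ₁ I → FuseFirstTarget R ((μ₁ , a) , I , (μₘ , b)) →
                       Chain μₘ (μ₁ ∸ μₘ) I × R (μ₁ ∸ μₘ) (topPart I μₘ + μₘ)
  unfuseFirst-source {μ₁} {I = I} {μₘ} c t with μ₁ ∸ μₘ | m∸n+n≡m (<⇒≤ (chain-lo<hi I c))
  unfuseFirst-source {I = I} {μₘ} c (t₁ , t₂) | d | refl =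
    Chain-capʳ I c (+-cancelʳ-< μₘ _ d t₁) , first-fused⁻ t₂

  fuseFirst-↔ : ∀ {S T} → ReadsAs frame S (FuseFirstSource R) → ReadsAs frame T (FuseFirstTarget R) →
                ∀ n → Σ (List Pair) (OfWeight S n) ↔ Σ (List Pair) (OfWeight T n)
  fuseFirst-↔ {S} {T} src tgt n =
    ↔-trans (Σ-frame-↔ (λ (_ , _ , s) → Src.nil s) (λ x (_ , _ , s) → Src.singleton x s))
   (↔-trans (inverseOn-↔ (OfWeight-irrelevant Src.irrelevant ∘ frame) (OfWeight-irrelevant Tgt.irrelevant ∘ frame)
                         fuseFirst unfuseFirst forward backward back-and-forth forth-and-back)
            (↔-sym (Σ-frame-↔ (λ (_ , _ , t) → Tgt.nil t) (λ x (_ , _ , t) → Tgt.singleton x t))))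
    where
    module Src = ReadsAs src
    module Tgt = ReadsAs tgt

    forward : ∀ {f} → OfWeight S n (frame f) → OfWeight T n (frame (fuseFirst f))
    forward {(l₁ , k₁) , I , (lₘ , kₘ)} (wf , w , s)
      with to (wellFormed⇔frameOK _) wf | to (Src.onView _) s
    ... | k₁>0 , c , _ , lₘ>0 | source@(_ , k₁<kₘ) =
      from (wellFormed⇔frameOK _)
        (k₁>0 , Chain-capʳ I c (<-≤-trans (chain-top I c) (m≤m+n l₁ lₘ)) , m<n⇒0<n∸m k₁<kₘ , lₘ>0) ,
      trans (weight-fuseFirst l₁ k₁ I lₘ kₘ (<⇒≤ k₁<kₘ)) w ,
      from (Tgt.onView _) (fuseFirst-target c source)

    backward : ∀ {f} → OfWeight T n (frame f) → OfWeight S n (frame (unfuseFirst f))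
    backward {(μ₁ , a) , I , (μₘ , b)} (wf , w , t) with to (wellFormed⇔frameOK _) wf
    ... | a>0 , c , b>0 , μₘ>0 with unfuseFirst-source {a = a} {b = b} c (to (Tgt.onView _) t)
    ... | c′ , r =
      from (wellFormed⇔frameOK _) (a>0 , c′ , ≤-trans b>0 (m≤m+n b a) , μₘ>0) ,
      trans (weight-unfuseFirst μ₁ a I μₘ b (<⇒≤ (chain-lo<hi I c))) w ,
      from (Src.onView _) (r , m<n+m a b>0)

    back-and-forth : ∀ {f} → OfWeight S n (frame f) → unfuseFirst (fuseFirst f) ≡ f
    back-and-forth (_ , _ , s) = unfuseFirst∘fuseFirst (<⇒≤ (proj₂ (to (Src.onView _) s)))

    forth-and-back : ∀ {f} → OfWeight T n (frame f) → fuseFirst (unfuseFirst f) ≡ f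
    forth-and-back {(μ₁ , a) , I , (μₘ , b)} (wf , _) =
      fuseFirst∘unfuseFirst (<⇒≤ (chain-lo<hi I (proj₁ (proj₂ (to (wellFormed⇔frameOK _) wf)))))

<×<-irrelevant : ∀ {a b c d} → Irrelevant (a < b × c < d)
<×<-irrelevant = ×-irrelevant <-irrelevant <-irrelevant

A00? : ∀ L → Dec (A00L L)
A00? []          = no λ ()
A00? (_ ∷ [])    = no λ ()
A00? (_ ∷ _ ∷ _) = (_ <? _) ×-dec (_ <? _)

A01? : ∀ L → Dec (A01L L)
A01? []          = no λ ()
A01? (_ ∷ [])    = no λ ()
A01? (_ ∷ _ ∷ _) = (_ <? _) ×-dec (_ <? _)

A10? : ∀ L → Dec (A10L L)
A10? []          = no λ ()
A10? (_ ∷ [])    = no λ ()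
A10? (_ ∷ _ ∷ _) = (_ <? _) ×-dec (_ <? _)

A11? : ∀ L → Dec (A11L L)
A11? []          = no λ ()
A11? (_ ∷ [])    = no λ ()
A11? (_ ∷ _ ∷ _) = (_ <? _) ×-dec (_ <? _)

A00-irrelevant : ∀ L → Irrelevant (A00L L)
A00-irrelevant []          ()
A00-irrelevant (_ ∷ [])    ()
A00-irrelevant (_ ∷ _ ∷ _) = <×<-irrelevant

A01-irrelevant : ∀ L → Irrelevant (A01L L)
A01-irrelevant []          ()
A01-irrelevant (_ ∷ [])    ()
A01-irrelevant (_ ∷ _ ∷ _) = <×<-irrelevant

A10-irrelevant : ∀ L → Irrelevant (A10L L)
A10-irrelevant []          ()
A10-irrelevant (_ ∷ [])    ()
A10-irrelevant (_ ∷ _ ∷ _) = <×<-irrelevant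

A11-irrelevant : ∀ L → Irrelevant (A11L L)
A11-irrelevant []          ()
A11-irrelevant (_ ∷ [])    ()
A11-irrelevant (_ ∷ _ ∷ _) = <×<-irrelevant

Tri00-irrelevant : ∀ L → Irrelevant (Tri00L L)
Tri00-irrelevant []              ()
Tri00-irrelevant (_ ∷ [])        ()
Tri00-irrelevant (_ ∷ _ ∷ [])    = <×<-irrelevant
Tri00-irrelevant (_ ∷ _ ∷ _ ∷ _) = <×<-irrelevant

Tri01-irrelevant : ∀ L → Irrelevant (Tri01L L)
Tri01-irrelevant []              ()
Tri01-irrelevant (_ ∷ [])        ()
Tri01-irrelevant (_ ∷ _ ∷ [])    = <×<-irrelevant
Tri01-irrelevant (_ ∷ _ ∷ _ ∷ _) = <×<-irrelevant

Tri10-irrelevant : ∀ L → Irrelevant (Tri10L L)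
Tri10-irrelevant []              ()
Tri10-irrelevant (_ ∷ [])        ()
Tri10-irrelevant (_ ∷ _ ∷ [])    = <×<-irrelevant
Tri10-irrelevant (_ ∷ _ ∷ _ ∷ _) = <×<-irrelevant

Tri11-irrelevant : ∀ L → Irrelevant (Tri11L L)
Tri11-irrelevant []              ()
Tri11-irrelevant (_ ∷ [])        ()
Tri11-irrelevant (_ ∷ _ ∷ [])    = <-irrelevant
Tri11-irrelevant (_ ∷ _ ∷ _ ∷ _) = <-irrelevant

A00-frame : ∀ f → A00L (frame f) ≡ FuseLastSource _<_ f
A00-frame (_ , []    , _) = refl
A00-frame (_ , y ∷ I , z) rewrite lastOf-∷ʳ y I z = refl

A01-frame : ∀ f → A01L (frame f) ≡ FuseLastSource _>_ f
A01-frame (_ , []    , _) = refl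
A01-frame (_ , y ∷ I , z) rewrite lastOf-∷ʳ y I z = refl

A10-frame : ∀ f → A10L (frame f) ≡ FuseFirstSource _<_ f
A10-frame (_ , []    , _) = refl
A10-frame (_ , y ∷ I , z) rewrite lastOf-∷ʳ y I z = refl

A11-frame : ∀ f → A11L (frame f) ≡ FuseFirstSource _>_ f
A11-frame (_ , []    , _) = refl
A11-frame (_ , y ∷ I , z) rewrite lastOf-∷ʳ y I z = refl

Tri00-head : ∀ h → Tri00L (cons₂ h) ≡ FuseLastTarget _<_ h
Tri00-head (_ , _ , [])    = refl
Tri00-head (_ , _ , _ ∷ _) = refl

Tri01-head : ∀ h → Tri01L (cons₂ h) ≡ FuseLastTarget _>_ h
Tri01-head (_ , _ , [])    = refl
Tri01-head (_ , _ , _ ∷ _) = refl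

Tri10-frame : ∀ f → Tri10L (frame f) ≡ FuseFirstTarget _<_ f
Tri10-frame ((μ₁ , _) , []    , (μₘ , _)) =
  cong (λ x → x < μ₁ × μ₁ < 3 * μₘ) (cong (μₘ +_) (+-identityʳ μₘ))
Tri10-frame (_         , _ ∷ []    , _) = refl
Tri10-frame (_         , _ ∷ y ∷ I , z) rewrite lastOf-∷ʳ y I z = refl

firstConjunct-implied : ∀ s m {l} → s + 2 * m < l ⇔ (s + m < l × s + 2 * m < l)
firstConjunct-implied s m = mk⇔ (λ t → ≤-<-trans (+-monoʳ-≤ s (m≤m+n m _)) t , t) proj₂

Tri11-frame : ∀ f → Tri11L (frame f) ⇔ FuseFirstTarget _>_ f
Tri11-frame (_ , []                , (μₘ , _)) = firstConjunct-implied μₘ μₘ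
Tri11-frame (_ , (l₂ , _) ∷ []    , (μₘ , _)) = firstConjunct-implied l₂ μₘ
Tri11-frame (_ , (l₂ , _) ∷ y ∷ I , (μₘ , b)) rewrite lastOf-∷ʳ y I (μₘ , b) =
  firstConjunct-implied l₂ μₘ

A00-reads : ReadsAs frame A00L (FuseLastSource _<_)
A00-reads = record
  { irrelevant = A00-irrelevant ; nil = λ () ; singleton = λ _ () ; onView = ≡⇒ ∘ A00-frame }

A01-reads : ReadsAs frame A01L (FuseLastSource _>_)
A01-reads = record
  { irrelevant = A01-irrelevant ; nil = λ () ; singleton = λ _ () ; onView = ≡⇒ ∘ A01-frame }

A10-reads : ReadsAs frame A10L (FuseFirstSource _<_)
A10-reads = record
  { irrelevant = A10-irrelevant ; nil = λ () ; singleton = λ _ () ; onView = ≡⇒ ∘ A10-frame }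

A11-reads : ReadsAs frame A11L (FuseFirstSource _>_)
A11-reads = record
  { irrelevant = A11-irrelevant ; nil = λ () ; singleton = λ _ () ; onView = ≡⇒ ∘ A11-frame }

Tri00-reads : ReadsAs cons₂ Tri00L (FuseLastTarget _<_)
Tri00-reads = record
  { irrelevant = Tri00-irrelevant ; nil = λ () ; singleton = λ _ () ; onView = ≡⇒ ∘ Tri00-head }

Tri01-reads : ReadsAs cons₂ Tri01L (FuseLastTarget _>_)
Tri01-reads = record
  { irrelevant = Tri01-irrelevant ; nil = λ () ; singleton = λ _ () ; onView = ≡⇒ ∘ Tri01-head }

Tri10-reads : ReadsAs frame Tri10L (FuseFirstTarget _<_)
Tri10-reads = record
  { irrelevant = Tri10-irrelevant ; nil = λ () ; singleton = λ _ () ; onView = ≡⇒ ∘ Tri10-frame }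

Tri11-reads : ReadsAs frame Tri11L (FuseFirstTarget _>_)
Tri11-reads = record
  { irrelevant = Tri11-irrelevant ; nil = λ () ; singleton = λ _ () ; onView = Tri11-frame }

mainTheorem7 : (n : ℕ) → 1 ≤ n →
    SameCount Tri00 A00 n × SameCount Tri01 A01 n × SameCount Tri10 A10 n × SameCount Tri11 A11 n
mainTheorem7 n _ =
  sameCount-by-↔ n A00? A00-irrelevant (fuseLast-↔  <-shiftInvariant A00-reads Tri00-reads n) ,
  sameCount-by-↔ n A01? A01-irrelevant (fuseLast-↔  >-shiftInvariant A01-reads Tri01-reads n) ,
  sameCount-by-↔ n A10? A10-irrelevant (fuseFirst-↔ <-shiftInvariant A10-reads Tri10-reads n) ,
  sameCount-by-↔ n A11? A11-irrelevant (fuseFirst-↔ >-shiftInvariant A11-reads Tri11-reads n)
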